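{- Let $G$ be a connected non-bipartite graph with diameter $D$. For any two arcs $e,e'$ of $\vec G$, $d(e,e')\le 4D+1$; moreover, there exists an alternating path connecting $e$ and $e'$ (with $e$ as first and $e'$ as last arc) containing at most $2D$ pairs of consecutive arcs sharing their ending vertex and at most $2D+1$ pairs of consecutive arcs sharing their starting vertex.
   Context: $G=(V,E)$ is a finite connected undirected graph with diameter $D$; $\vec G$ is obtained by replacing each edge $\{u,v\}$ by the two arcs $(u,v),(v,u)$. A sequence of arcs $e_1,e_2,\dots,e_p$ is an alternating path of length $p-1$ if either every pair $e_{2i},e_{2i+1}$ shares its starting vertex and every pair $e_{2i-1},e_{2i}$ shares its ending vertex, or vice versa (every pair $e_{2i},e_{2i+1}$ shares its ending vertex and every pair $e_{2i-1},e_{2i}$ shares its starting vertex). The distance $d(e,e')$ between arcs $e,e'$ is the length of a shortest alternating path having $e$ as first and $e'$ as last arc. -}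

module Defs where

open import Data.Nat using (ℕ; zero; suc; _+_; _≤_; _<_)
open import Data.Fin using (Fin)
open import Data.Bool using (Bool)
open import Data.Product using (Σ; ∃; ∃-syntax; _×_; _,_; proj₁; proj₂)
open import Relation.Binary.PropositionalEquality using (_≡_; _≢_)
open import Relation.Nullary using (¬_)

record Graph (n : ℕ) : Set₁ where
  field
    Adj   : Fin n → Fin n → Set
    sym   : ∀ {u v} → Adj u v → Adj v u
    irref : ∀ {u} → ¬ Adj u u

module _ {n : ℕ} (G : Graph n) where
  open Graph G

  data Walk : Fin n → Fin n → ℕ → Set where
    nil  : ∀ {u} → Walk u u 0
    cons : ∀ {u v w k} → Adj u v → Walk v w k → Walk u w (suc k)

  Connected : Set
  Connected = ∀ u v → ∃[ k ] Walk u v k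

  IsDist : Fin n → Fin n → ℕ → Set
  IsDist u v k = Walk u v k × (∀ j → j < k → ¬ Walk u v j)

  HasDiameter : ℕ → Set
  HasDiameter D = (∀ u v → ∃[ k ] (IsDist u v k × k ≤ D))
                × (∃[ u ] ∃[ v ] IsDist u v D)

  Bipartite : Set
  Bipartite = Σ (Fin n → Bool) λ c → ∀ {u v} → Adj u v → c u ≢ c v

  Arc : Set
  Arc = Σ (Fin n × Fin n) λ p → Adj (proj₁ p) (proj₂ p)

  start end : Arc → Fin n
  start e = proj₁ (proj₁ e)
  end   e = proj₂ (proj₁ e)

  data Kind : Set where
    sharesStart sharesEnd : Kind

  other : Kind → Kind
  other sharesStart = sharesEnd
  other sharesEnd   = sharesStart

  Shares : Kind → Arc → Arc → Set
  Shares sharesStart e f = start e ≡ start f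
  Shares sharesEnd   e f = end e ≡ end f

  -- AltPath k e e' p : alternating path e = e₁, …, e_{p+1} = e' of length p
  -- whose first consecutive pair (if any) is of kind k, kinds alternating.
  data AltPath : Kind → Arc → Arc → ℕ → Set where
    single : ∀ {k e} → AltPath k e e 0
    step   : ∀ {k e f e' p} → Shares k e f → AltPath (other k) f e' p
           → AltPath k e e' (suc p)

  count : Kind → ∀ {k e e' p} → AltPath k e e' p → ℕ
  count κ single = 0
  count sharesStart (step {k = sharesStart} _ q) = suc (count sharesStart q)
  count sharesStart (step {k = sharesEnd}   _ q) = count sharesStart q
  count sharesEnd   (step {k = sharesEnd}   _ q) = suc (count sharesEnd q)
  count sharesEnd   (step {k = sharesStart} _ q) = count sharesEnd q

  DistAtMost : Arc → Arc → ℕ → Set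
  DistAtMost e e' m = ∃[ k ] ∃[ p ] (AltPath k e e' p × p ≤ m)

-- Fix vertices x and y.  Since G is not bipartite, colouring vertices by the
-- parity of their distance from x leaves some edge uv monochromatic; one of the walks
-- x ⇝ v ⇝ y and x ⇝ u → v ⇝ y along shortest paths is therefore odd, so x
-- and y are joined by an odd walk of length at most 2D + 1.  An odd
-- walk from end e to start e' becomes an alternating path from e to e' that
-- begins with a shared end: each edge of the walk contributes one arc sharing
-- the current pivot vertex with the previous arc.  The two kinds of pairs
-- then alternate, so among at most 2D + 2 pairs each kind occurs at most
-- D + 1 ≤ 2D times (D ≥ 1, as G has an edge).
module Submission where

open import Defs
open import Data.Nat using (ℕ; _+_; _*_; _≤_)
open import Data.Product using (_×_; ∃-syntax)
open import Relation.Nullary using (¬_)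

open import Data.Nat.Base using (zero; suc; z≤n; s≤s; parity; ⌊_/2⌋; ⌈_/2⌉)
open import Data.Nat.Properties
  using (≤-trans; ≤-reflexive; m≤m+n; m≤n⇒m≤1+n; m≤n⇒m≤n+o; m<m+n; +-suc; +-mono-≤;
         ⌈n/2⌉-mono; ⌊n/2⌋≤⌈n/2⌉; n≡⌈n+n/2⌉; module ≤-Reasoning)
open import Data.Nat.Tactic.RingSolver using (solve-∀)
open import Data.Parity.Base using (Parity; 0ℙ; 1ℙ; _⁻¹) renaming (_+_ to _+ℙ_)
open import Data.Parity.Properties using (+-homo-+)
open import Data.Fin using (Fin)
open import Data.Fin.Properties using (any?)
open import Data.Bool using (Bool; true; false)
open import Data.Bool.Properties using () renaming (_≟_ to _≟ᴮ_)
open import Data.Product using (_,_; proj₁; proj₂)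
open import Data.Sum using (_⊎_; inj₁; inj₂)
open import Relation.Nullary using (Dec; yes; no; contradiction)
open import Relation.Nullary.Decidable using (_×-dec_)
open import Relation.Binary.PropositionalEquality
  using (_≡_; refl; sym; trans; cong; subst; module ≡-Reasoning)

toBool : Parity → Bool
toBool 0ℙ = false
toBool 1ℙ = true

toBool-injective : ∀ {p q} → toBool p ≡ toBool q → p ≡ q
toBool-injective {0ℙ} {0ℙ} _ = refl
toBool-injective {1ℙ} {1ℙ} _ = refl

parity-suc : ∀ n → parity (suc n) ≡ parity n ⁻¹
parity-suc n = +-homo-+ 1 n

odd-+-or-odd-+-suc : ∀ a b c → parity a ≡ parity b
                   → parity (b + c) ≡ 1ℙ ⊎ parity (a + suc c) ≡ 1ℙ
odd-+-or-odd-+-suc a b c pa≡pb with parity (b + c) in eq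
... | 1ℙ = inj₁ refl
... | 0ℙ = inj₂ (begin
  parity (a + suc c)              ≡⟨ cong parity (+-suc a c) ⟩
  parity (suc (a + c))            ≡⟨ parity-suc (a + c) ⟩
  parity (a + c) ⁻¹               ≡⟨ cong _⁻¹ (+-homo-+ a c) ⟩
  (parity a +ℙ parity c) ⁻¹       ≡⟨ cong (λ p → (p +ℙ parity c) ⁻¹) pa≡pb ⟩
  (parity b +ℙ parity c) ⁻¹       ≡⟨ cong _⁻¹ (sym (+-homo-+ b c)) ⟩
  parity (b + c) ⁻¹               ≡⟨ cong _⁻¹ eq ⟩
  1ℙ                              ∎)
  where open ≡-Reasoning

⌈suc/2⌉≤suc : ∀ {m} D → m ≤ suc (D + D) → ⌈ suc m /2⌉ ≤ suc D
⌈suc/2⌉≤suc D m≤ = ≤-trans (⌈n/2⌉-mono (s≤s m≤)) (s≤s (≤-reflexive (sym (n≡⌈n+n/2⌉ D))))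

suc≤2* : ∀ {D} → 1 ≤ D → suc D ≤ 2 * D
suc≤2* {suc d} _ = m<m+n (suc d) (s≤s z≤n)

2+double≤4*+1 : ∀ {D} → 1 ≤ D → 2 + (D + D) ≤ 4 * D + 1
2+double≤4*+1 {suc d} _ = begin
  2 + (D + D)                    ≤⟨ m≤m+n (2 + (D + D)) (d + d + 1) ⟩
  2 + (D + D) + (d + d + 1)      ≡⟨ identity d ⟩
  4 * D + 1                      ∎
  where
  open ≤-Reasoning
  D = suc d
  identity : ∀ d → 2 + (suc d + suc d) + (d + d + 1) ≡ 4 * suc d + 1
  identity = solve-∀

module _ {n : ℕ} (G : Graph n) where
  open Graph G using (Adj; irref) renaming (sym to Adj-sym)

  walk-zero : ∀ {u v} → Walk G u v 0 → u ≡ v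
  walk-zero nil = refl

  _++ᵂ_ : ∀ {u v w a b} → Walk G u v a → Walk G v w b → Walk G u w (a + b)
  nil      ++ᵂ q = q
  cons x p ++ᵂ q = cons x (p ++ᵂ q)

  Adj⇒¬Walk0 : ∀ {u v} → Adj u v → ¬ Walk G u v 0
  Adj⇒¬Walk0 {u} a w = irref (subst (Adj u) (sym (walk-zero w)) a)

  Adj⇒1≤dist : ∀ {u v k} → Adj u v → IsDist G u v k → 1 ≤ k
  Adj⇒1≤dist {k = zero}  a (w , _) = contradiction w (Adj⇒¬Walk0 a)
  Adj⇒1≤dist {k = suc k} _ _       = s≤s z≤n

  -- Adjacency is not assumed decidable, but it is exactly "distance 1".
  adjacent? : ∀ {u v k} → IsDist G u v k → Dec (Adj u v)
  adjacent? {k = zero}        (w , _)        = no (λ a → Adj⇒¬Walk0 a w)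
  adjacent? {k = suc zero}    (cons a nil , _) = yes a
  adjacent? {k = suc (suc k)} (_ , shortest) = no (λ a → shortest 1 (s≤s (s≤s z≤n)) (cons a nil))

  ¬Bipartite⇒monochromatic-edge : (∀ u v → Dec (Adj u v)) → ¬ Bipartite G
    → (c : Fin n → Bool) → ∃[ u ] ∃[ v ] (Adj u v × c u ≡ c v)
  ¬Bipartite⇒monochromatic-edge Adj? nonbip c
    with any? (λ u → any? (λ v → Adj? u v ×-dec (c u ≟ᴮ c v)))
  ... | yes edge = edge
  ... | no ¬edge = contradiction (c , λ {u} {v} a cu≡cv → ¬edge (u , v , a , cu≡cv)) nonbip

  module _ {D : ℕ} (diameter : HasDiameter G D) where
    dist : Fin n → Fin n → ℕ
    dist u v = proj₁ (proj₁ diameter u v)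

    dist-isDist : ∀ u v → IsDist G u v (dist u v)
    dist-isDist u v = proj₁ (proj₂ (proj₁ diameter u v))

    dist≤D : ∀ u v → dist u v ≤ D
    dist≤D u v = proj₂ (proj₂ (proj₁ diameter u v))

    geodesic : ∀ u v → Walk G u v (dist u v)
    geodesic u v = proj₁ (dist-isDist u v)

    1≤diameter : Arc G → 1 ≤ D
    1≤diameter ((u , v) , a) = ≤-trans (Adj⇒1≤dist a (dist-isDist u v)) (dist≤D u v)

    odd-walk : ¬ Bipartite G → ∀ x y
             → ∃[ m ] (Walk G x y m × parity m ≡ 1ℙ × m ≤ suc (D + D))
    odd-walk nonbip x y
      with ¬Bipartite⇒monochromatic-edge (λ u v → adjacent? (dist-isDist u v)) nonbip
             (λ u → toBool (parity (dist x u)))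
    ... | u , v , a , same-colour
      with odd-+-or-odd-+-suc (dist x u) (dist x v) (dist v y) (toBool-injective same-colour)
    ... | inj₁ odd = _ , geodesic x v ++ᵂ geodesic v y , odd ,
                     m≤n⇒m≤1+n (+-mono-≤ (dist≤D x v) (dist≤D v y))
    ... | inj₂ odd = _ , geodesic x u ++ᵂ cons a (geodesic v y) , odd ,
                     subst (dist x u + suc (dist v y) ≤_) (+-suc D D) (+-mono-≤ (dist≤D x u) (s≤s (dist≤D v y)))

  pivot : Kind G → Arc G → Fin n
  pivot sharesStart = start G
  pivot sharesEnd   = end G

  pivot≡⇒Shares : ∀ k {e f} → pivot k e ≡ pivot k f → Shares G k e f
  pivot≡⇒Shares sharesStart eq = eq
  pivot≡⇒Shares sharesEnd   eq = eq

  other-involutive : ∀ k → other G (other G k) ≡ k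
  other-involutive sharesStart = refl
  other-involutive sharesEnd   = refl

  other^ : ℕ → Kind G → Kind G
  other^ zero    k = k
  other^ (suc m) k = other^ m (other G k)

  other^-odd : ∀ m k → parity m ≡ 1ℙ → other^ m k ≡ other G k
  other^-odd (suc zero)    k _   = refl
  other^-odd (suc (suc m)) k odd =
    trans (other^-odd m (other G (other G k)) odd) (cong (other G) (other-involutive k))

  -- The edge u → v of the walk at pivot u = pivot k e becomes the arc through
  -- u and v that shares pivot k with e; its far endpoint v is the next pivot.
  walk⇒AltPath : ∀ k e e' m → Walk G (pivot k e) (pivot (other^ m k) e') m
               → AltPath G k e e' (suc m)
  walk⇒AltPath k e e' zero w = step (pivot≡⇒Shares k (walk-zero w)) single
  walk⇒AltPath sharesStart e e' (suc m) (cons {v = v} a w) =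
    step {f = (start G e , v) , a} refl (walk⇒AltPath sharesEnd _ e' m w)
  walk⇒AltPath sharesEnd e e' (suc m) (cons {v = v} a w) =
    step {f = (v , end G e) , Adj-sym a} refl (walk⇒AltPath sharesStart _ e' m w)

  count-alternating : ∀ {k e e' p} (P : AltPath G k e e' p)
                    → count G k P ≡ ⌈ p /2⌉ × count G (other G k) P ≡ ⌊ p /2⌋
  count-alternating single = refl , refl
  count-alternating (step {k = sharesStart} _ P) with count-alternating P
  ... | other≡ , k≡ = cong suc k≡ , other≡
  count-alternating (step {k = sharesEnd} _ P) with count-alternating P
  ... | other≡ , k≡ = cong suc k≡ , other≡

-- Connectivity is implied by the diameter hypothesis.
lemma4 : ∀ {n : ℕ} (G : Graph n) (D : ℕ)
    → Connected G → ¬ Bipartite G → HasDiameter G D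
    → ∀ (e e' : Arc G)
    → DistAtMost G e e' (4 * D + 1)
    × (∃[ k ] ∃[ p ] ∃[ P ] (count G (sharesEnd) {k} {e} {e'} {p} P ≤ 2 * D
    × count G sharesStart P ≤ 2 * D + 1))
lemma4 G D _ nonbip diameter e e'
  with odd-walk G diameter nonbip (end G e) (start G e')
... | m , w , odd , m≤ =
  (sharesEnd , suc m , path , ≤-trans (s≤s m≤) (2+double≤4*+1 1≤D)) ,
  (sharesEnd , suc m , path ,
     subst (_≤ 2 * D) (sym ends) half≤ ,
     subst (_≤ 2 * D + 1) (sym starts)
       (≤-trans (⌊n/2⌋≤⌈n/2⌉ (suc m)) (m≤n⇒m≤n+o 1 half≤)))
  where
  1≤D : 1 ≤ D
  1≤D = 1≤diameter G diameter e
  path : AltPath G sharesEnd e e' (suc m)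
  path = walk⇒AltPath G sharesEnd e e' m
           (subst (λ k → Walk G (end G e) (pivot G k e') m) (sym (other^-odd G m sharesEnd odd)) w)
  ends : count G sharesEnd path ≡ ⌈ suc m /2⌉
  ends = proj₁ (count-alternating G path)
  starts : count G sharesStart path ≡ ⌊ suc m /2⌋
  starts = proj₂ (count-alternating G path)
  half≤ : ⌈ suc m /2⌉ ≤ 2 * D
  half≤ = ≤-trans (⌈suc/2⌉≤suc D m≤) (suc≤2* 1≤D)
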